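{- Let $N\geqslant 1$ and let $K_N=\max_{0\leqslant k\leqslant N}\binom{N}{k}$. Let $w$ be a balanced word of length $\ell$ over an $N$-letter alphabet $A_N$ in which each of the $N$ letters occurs at least once. Then $\rho^{\mathrm{ab}}_n(w)\leqslant K_N$ for all $1\leqslant n\leqslant \ell$. Likewise, if $[w]$ is a balanced circular word of length $\ell$ over $A_N$ in which each of the $N$ letters occurs, then $\rho^{\mathrm{ab}}_n[w]\leqslant K_N$ for all $1\leqslant n\leqslant \ell$.
   Context: Words are finite sequences of letters from the alphabet $A_N$; a factor of $w$ is a contiguous subword $u$ with $w=vuv'$. The Parikh vector of a word $u$ is $\Psi(u)=\sum_{a\in A_N}|u|_a\,a$ (formal integer combination of letters), where $|u|_a$ is the number of occurrences of $a$ in $u$. A nonempty word $w$ is balanced if for all factors $u,v$ of $w$ with $|u|=|v|$, every coefficient of $\Psi(u)-\Psi(v)$ lies in $\{ -1,0,1\}$. A circular word $[w]$ is the class of $w$ under cyclic shifts (conjugation $a_1a_2\dots a_\ell\mapsto a_2\dots a_\ell a_1$); it has length $|w|$; its factors are the factors of its representatives; $[w]$ is balanced if every representative is balanced. For a word $w$ of length $\ell$ and $1\leqslant n\leqslant\ell$, the $n$-spectrum is $\mathrm{spec}_n w=\{\Psi(u): u \text{ a factor of } w,\ |u|=n\}$, and $\mathrm{spec}_n[w]$ is the union of $\mathrm{spec}_n w'$ over all representatives $w'$ of $[w]$. The abelian complexity is $\rho^{\mathrm{ab}}_n(w)=\#\mathrm{spec}_n w$ and $\rho^{\mathrm{ab}}_n[w]=\#\mathrm{spec}_n[w]$.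 -}

module Defs where

open import Data.Nat using (ℕ; zero; suc; _+_; _≤_; _<_; _⊔_)
open import Data.Nat.Combinatorics using (_C_)
open import Data.Fin using (Fin)
open import Data.List using (List; []; _∷_; _++_; length; map; upTo; foldr; take; drop; deduplicate; applyUpTo)
open import Data.List.Membership.Propositional using (_∈_)
open import Data.Vec using (Vec; tabulate)
import Data.Vec.Properties as VecP
open import Data.Nat.Properties using (_≟_)
open import Data.Fin.Properties using () renaming (_≟_ to _≟ᶠ_)
open import Data.Integer using (ℤ; +_; _-_; ∣_∣)
open import Data.Product using (Σ; ∃; _×_; _,_)
open import Relation.Binary.PropositionalEquality using (_≡_)
open import Relation.Nullary using (yes; no)

Word : ℕ → Set
Word N = List (Fin N)

count : ∀ {N} → Fin N → Word N → ℕ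
count a [] = 0
count a (b ∷ u) with a ≟ᶠ b
... | yes _ = suc (count a u)
... | no _  = count a u

Ψ : ∀ {N} → Word N → Vec ℕ N
Ψ u = tabulate (λ a → count a u)

Factor : ∀ {N} → Word N → Word N → Set
Factor {N} u w = Σ (Word N) λ v → Σ (Word N) λ v' → w ≡ v ++ (u ++ v')

Balanced : ∀ {N} → Word N → Set
Balanced {N} w =
  (w ≡ [] → Data.Empty.⊥) ×
  (∀ (u v : Word N) → Factor u w → Factor v w → length u ≡ length v →
     ∀ (a : Fin N) → ∣ (+ count a u) - (+ count a v) ∣ ≤ 1)
  where import Data.Empty

rotate : ∀ {N} → ℕ → Word N → Word N
rotate k w = drop k w ++ take k w

-- the representatives of [w] are rotate k w for k < |w|
-- (for w = [] the only representative is w itself)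
Representative : ∀ {N} → Word N → Word N → Set
Representative w w' = (w ≡ [] × w' ≡ w) ⊎ (Σ ℕ λ k → k < length w × w' ≡ rotate k w)
  where open import Data.Sum using (_⊎_)

BalancedCircular : ∀ {N} → Word N → Set
BalancedCircular w = ∀ w' → Representative w w' → Balanced w'

AllLettersOccur : ∀ {N} → Word N → Set
AllLettersOccur {N} w = ∀ (a : Fin N) → a ∈ w

factorsOfLength : ∀ {N} → ℕ → Word N → List (Word N)
factorsOfLength n w = applyUpTo (λ i → take n (drop i w)) (suc (length w Data.Nat.∸ n))
  where import Data.Nat

circFactorsOfLength : ∀ {N} → ℕ → Word N → List (Word N)
circFactorsOfLength n w =
  Data.List.concatMap (λ k → factorsOfLength n (rotate k w)) (upTo (length w))
  where import Data.List

#distinct : ∀ {N} → List (Vec ℕ N) → ℕ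
#distinct xs = length (deduplicate (VecP.≡-dec _≟_) xs)

spec : ∀ {N} → ℕ → Word N → List (Vec ℕ N)
spec n w = map Ψ (factorsOfLength n w)

ρab : ∀ {N} → ℕ → Word N → ℕ
ρab n w = #distinct (spec n w)

specCirc : ∀ {N} → ℕ → Word N → List (Vec ℕ N)
specCirc n w = map Ψ (circFactorsOfLength n w)

ρabCirc : ∀ {N} → ℕ → Word N → ℕ
ρabCirc n w = #distinct (specCirc n w)

K : ℕ → ℕ
K N = foldr _⊔_ 0 (map (N C_) (upTo (suc N)))

module Submission where

-- For each letter a, balance confines the counts |u|ₐ over the length-n factors u to two
-- consecutive values mₐ and mₐ + 1. So every Parikh vector of such a factor is m plus a 0/1-vector,
-- which must have exactly n ∸ Σ m ones: there are at most C(N, n ∸ Σ m) ≤ K N of them.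
-- Two arcs of length n of a circular word are compared inside one rotation x of it: either both
-- are factors of x, or their complementary arcs of length |x| ∸ n are; complementary counts add
-- up to |x|ₐ, so balance of the complements carries over to the arcs.

open import Defs
open import Data.Nat using (ℕ; zero; suc; _+_; _∸_; _≤_; _<_; _⊔_; _⊓_; z≤n; s≤s)
open import Data.Nat.Properties
open import Data.Nat.Combinatorics using (_C_; nCk+nC[k+1]≡[n+1]C[k+1])
open import Data.Nat.Combinatorics.Specification using (k>n⇒nCk≡0)
open import Data.Fin using (Fin; zero; suc)
open import Data.Fin.Properties using () renaming (_≟_ to _≟ᶠ_; suc-injective to suc-injectiveᶠ)
open import Data.Integer using (_⊖_; ∣_∣)
open import Data.Integer.Properties using ([1+m]⊖[1+n]≡m⊖n; m-n≡m⊖n)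
open import Data.List using (List; []; _∷_; [_]; _++_; length; map; upTo; foldr; take; drop)
open import Data.List.Properties
  using (length-++; length-map; length-take; length-drop; length-removeAt′; take-[]; take++drop≡id; drop-drop; ++-assoc; foldr-preservesᵒ)
open import Data.List.Extrema.Nat using (argmin; argmin-sel; f[argmin]≤f[⊤]; f[argmin]≤f[xs])
open import Data.List.Membership.Propositional using (_∈_; find; lose)
open import Data.List.Membership.Propositional.Properties
  using (∈-map⁺; ∈-map⁻; ∈-++⁺ˡ; ∈-++⁺ʳ; ∈-upTo⁺; ∈-upTo⁻; ∈-applyUpTo⁻; ∈-concatMap⁻; ∈-deduplicate⁻)
open import Data.List.Relation.Binary.Subset.Propositional using (_⊆_)
open import Data.List.Relation.Unary.Any using (here; there; index; _─_)
open import Data.List.Relation.Unary.All using (_∷_)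
import Data.List.Relation.Unary.All as All
open import Data.List.Relation.Unary.AllPairs using (_∷_)
open import Data.List.Relation.Unary.Unique.Propositional using (Unique)
open import Data.Vec using (Vec; []; _∷_; sum; tabulate; lookup)
import Data.Vec.Properties as Vecₚ
open import Data.Product using (∃; _×_; _,_; proj₁; proj₂; map₂)
open import Data.Sum using (inj₁; inj₂; [_,_]′)
open import Data.Empty using (⊥-elim)
open import Function using (_∘_)
open import Relation.Binary.PropositionalEquality using (_≡_; _≢_; refl; sym; trans; cong; cong₂; subst; subst₂; module ≡-Reasoning)
open import Relation.Nullary using (yes; no)

m+n≤o⇒n≤o∸m : ∀ m {n o} → m + n ≤ o → n ≤ o ∸ m
m+n≤o⇒n≤o∸m m {n} {o} m+n≤o = m+n≤o⇒m≤o∸n n (subst (_≤ o) (+-comm m n) m+n≤o)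

∣⊖∣≤1⇒≤suc : ∀ x y → ∣ x ⊖ y ∣ ≤ 1 → x ≤ suc y
∣⊖∣≤1⇒≤suc zero          y       _               = z≤n
∣⊖∣≤1⇒≤suc (suc zero)    zero    _               = s≤s z≤n
∣⊖∣≤1⇒≤suc (suc (suc x)) zero    (s≤s ())
∣⊖∣≤1⇒≤suc (suc x)       (suc y) ∣1+x⊖1+y∣≤1 =
  s≤s (∣⊖∣≤1⇒≤suc x y (subst (λ z → ∣ z ∣ ≤ 1) ([1+m]⊖[1+n]≡m⊖n x y) ∣1+x⊖1+y∣≤1))

module _ {A : Set} where

  ∈-─ : ∀ {x y : A} xs (x∈xs : x ∈ xs) → y ∈ xs → y ≢ x → y ∈ (xs ─ x∈xs)
  ∈-─ (_ ∷ _)  (here refl) (here refl) y≢x = ⊥-elim (y≢x refl)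
  ∈-─ (_ ∷ _)  (here refl) (there y∈xs) _  = y∈xs
  ∈-─ (_ ∷ _)  (there _)   (here refl) _   = here refl
  ∈-─ (_ ∷ xs) (there x∈xs) (there y∈xs) y≢x = there (∈-─ xs x∈xs y∈xs y≢x)

  Unique-⊆⇒length≤ : ∀ {xs ys : List A} → Unique xs → xs ⊆ ys → length xs ≤ length ys
  Unique-⊆⇒length≤ {[]}     _                 _     = z≤n
  Unique-⊆⇒length≤ {x ∷ xs} {ys} (x∉xs ∷ uniq) xs⊆ys = begin
    suc (length xs)          ≤⟨ s≤s (Unique-⊆⇒length≤ uniq xs⊆ys─x) ⟩
    suc (length (ys ─ x∈ys)) ≡⟨ length-removeAt′ ys (index x∈ys) ⟨
    length ys                ∎
    where
    open ≤-Reasoning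
    x∈ys : x ∈ ys
    x∈ys = xs⊆ys (here refl)
    xs⊆ys─x : xs ⊆ (ys ─ x∈ys)
    xs⊆ys─x y∈xs = ∈-─ ys x∈ys (xs⊆ys (there y∈xs)) (All.lookup x∉xs y∈xs ∘ sym)

  take-+ : ∀ m k (xs : List A) → take (m + k) xs ≡ take m xs ++ take k (drop m xs)
  take-+ zero    k xs       = refl
  take-+ (suc m) k []       = sym (take-[] k)
  take-+ (suc m) k (x ∷ xs) = cong (x ∷_) (take-+ m k xs)

  take-++ˡ : ∀ m (xs ys : List A) → m ≤ length xs → take m (xs ++ ys) ≡ take m xs
  take-++ˡ zero    xs       ys _         = refl
  take-++ˡ (suc m) (x ∷ xs) ys (s≤s m≤) = cong (x ∷_) (take-++ˡ m xs ys m≤)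

  drop-++ˡ : ∀ p (xs ys : List A) → p ≤ length xs → drop p (xs ++ ys) ≡ drop p xs ++ ys
  drop-++ˡ zero    xs       ys _         = refl
  drop-++ˡ (suc p) (x ∷ xs) ys (s≤s p≤) = drop-++ˡ p xs ys p≤

  take-drop-++ˡ : ∀ p m (xs ys : List A) → p + m ≤ length xs →
                  take m (drop p (xs ++ ys)) ≡ take m (drop p xs)
  take-drop-++ˡ zero    m xs       ys p+m≤       = take-++ˡ m xs ys p+m≤
  take-drop-++ˡ (suc p) m (x ∷ xs) ys (s≤s p+m≤) = take-drop-++ˡ p m xs ys p+m≤

  take-length-++ : ∀ (xs ys : List A) m → take (length xs + m) (xs ++ ys) ≡ xs ++ take m ys
  take-length-++ []       ys m = refl
  take-length-++ (x ∷ xs) ys m = cong (x ∷_) (take-length-++ xs ys m)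

  drop-length-++ : ∀ (xs ys : List A) p → drop (length xs + p) (xs ++ ys) ≡ drop p ys
  drop-length-++ []       ys p = refl
  drop-length-++ (x ∷ xs) ys p = drop-length-++ xs ys p

  length-take-drop : ∀ p m (xs : List A) → p + m ≤ length xs → length (take m (drop p xs)) ≡ m
  length-take-drop p m xs p+m≤ = begin
    length (take m (drop p xs)) ≡⟨ length-take m (drop p xs) ⟩
    m ⊓ length (drop p xs)      ≡⟨ m≤n⇒m⊓n≡m m≤ ⟩
    m                           ∎
    where
    open ≡-Reasoning
    m≤ : m ≤ length (drop p xs)
    m≤ = subst (m ≤_) (sym (length-drop p xs)) (m+n≤o⇒n≤o∸m p p+m≤)

sum-tabulate-bump : ∀ {n} (f g : Fin n → ℕ) b → g b ≡ suc (f b) → (∀ a → a ≢ b → g a ≡ f a) →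
                    sum (tabulate g) ≡ suc (sum (tabulate f))
sum-tabulate-bump f g zero    gb≡ g≡f =
  cong₂ _+_ gb≡ (cong sum (Vecₚ.tabulate-cong (λ a → g≡f (suc a) λ ())))
sum-tabulate-bump f g (suc b) gb≡ g≡f = begin
  g zero + sum (tabulate (g ∘ suc))       ≡⟨ cong₂ _+_ (g≡f zero λ ()) (sum-tabulate-bump (f ∘ suc) (g ∘ suc) b gb≡ g≡f∘suc) ⟩
  f zero + suc (sum (tabulate (f ∘ suc))) ≡⟨ +-suc (f zero) _ ⟩
  suc (sum (tabulate f))                  ∎
  where
  open ≡-Reasoning
  g≡f∘suc : ∀ a → a ≢ b → g (suc a) ≡ f (suc a)
  g≡f∘suc a a≢b = g≡f (suc a) (a≢b ∘ suc-injectiveᶠ)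

module _ {N : ℕ} where

  count-++ : ∀ (a : Fin N) u v → count a (u ++ v) ≡ count a u + count a v
  count-++ a []      v = refl
  count-++ a (b ∷ u) v with a ≟ᶠ b
  ... | yes _ = cong suc (count-++ a u v)
  ... | no  _ = count-++ a u v

  count-rotate : ∀ (a : Fin N) k w → count a (rotate k w) ≡ count a w
  count-rotate a k w = begin
    count a (drop k w ++ take k w)          ≡⟨ count-++ a (drop k w) (take k w) ⟩
    count a (drop k w) + count a (take k w) ≡⟨ +-comm (count a (drop k w)) _ ⟩
    count a (take k w) + count a (drop k w) ≡⟨ count-++ a (take k w) (drop k w) ⟨
    count a (take k w ++ drop k w)          ≡⟨ cong (count a) (take++drop≡id k w) ⟩
    count a w                               ∎
    where open ≡-Reasoning

  take-drop-Factor : ∀ m p (w : Word N) → Factor (take m (drop p w)) w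
  take-drop-Factor m p w = take p w , drop m (drop p w) , sym (begin
    take p w ++ (take m (drop p w) ++ drop m (drop p w)) ≡⟨ cong (take p w ++_) (take++drop≡id m (drop p w)) ⟩
    take p w ++ drop p w                                 ≡⟨ take++drop≡id p w ⟩
    w                                                    ∎)
    where open ≡-Reasoning

  sum-Ψ : ∀ (u : Word N) → sum (Ψ u) ≡ length u
  sum-Ψ []      = sum-zeros N
    where
    sum-zeros : ∀ n → sum (tabulate {n = n} λ _ → 0) ≡ 0
    sum-zeros zero    = refl
    sum-zeros (suc n) = sum-zeros n
  sum-Ψ (b ∷ u) = trans (sum-tabulate-bump (λ a → count a u) (λ a → count a (b ∷ u)) b count-self count-other)
                        (cong suc (sum-Ψ u))
    where
    count-self : count b (b ∷ u) ≡ suc (count b u)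
    count-self with b ≟ᶠ b
    ... | yes _   = refl
    ... | no  b≢b = ⊥-elim (b≢b refl)
    count-other : ∀ a → a ≢ b → count a (b ∷ u) ≡ count a u
    count-other a a≢b with a ≟ᶠ b
    ... | yes a≡b = ⊥-elim (a≢b a≡b)
    ... | no  _   = refl

data Bump : ∀ {n} → Vec ℕ n → ℕ → Vec ℕ n → Set where
  []   : Bump [] 0 []
  keep : ∀ {n x k} {m v : Vec ℕ n} → Bump m k v → Bump (x ∷ m) k (x ∷ v)
  bump : ∀ {n x k} {m v : Vec ℕ n} → Bump m k v → Bump (x ∷ m) (suc k) (suc x ∷ v)

bumps : ∀ {n} → Vec ℕ n → ℕ → List (Vec ℕ n)
bumps []      zero    = [ [] ]
bumps []      (suc k) = []
bumps (x ∷ m) zero    = map (x ∷_) (bumps m zero)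
bumps (x ∷ m) (suc k) = map (x ∷_) (bumps m (suc k)) ++ map (suc x ∷_) (bumps m k)

length-bumps : ∀ {n} (m : Vec ℕ n) k → length (bumps m k) ≡ n C k
length-bumps []      zero    = refl
length-bumps []      (suc k) = refl
length-bumps (x ∷ m) zero    = trans (length-map (x ∷_) (bumps m zero)) (length-bumps m zero)
length-bumps {suc n} (x ∷ m) (suc k) = begin
  length (map (x ∷_) (bumps m (suc k)) ++ map (suc x ∷_) (bumps m k))
    ≡⟨ length-++ (map (x ∷_) (bumps m (suc k))) ⟩
  length (map (x ∷_) (bumps m (suc k))) + length (map (suc x ∷_) (bumps m k))
    ≡⟨ cong₂ _+_ (length-map (x ∷_) (bumps m (suc k))) (length-map (suc x ∷_) (bumps m k)) ⟩
  length (bumps m (suc k)) + length (bumps m k)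
    ≡⟨ cong₂ _+_ (length-bumps m (suc k)) (length-bumps m k) ⟩
  n C suc k + n C k
    ≡⟨ +-comm (n C suc k) (n C k) ⟩
  n C k + n C suc k
    ≡⟨ nCk+nC[k+1]≡[n+1]C[k+1] n k ⟩
  suc n C suc k ∎
  where open ≡-Reasoning

Bump⇒∈bumps : ∀ {n} {m v : Vec ℕ n} {k} → Bump m k v → v ∈ bumps m k
Bump⇒∈bumps []                          = here refl
Bump⇒∈bumps {k = zero}  (keep b)        = ∈-map⁺ _ (Bump⇒∈bumps b)
Bump⇒∈bumps {k = suc k} (keep b)        = ∈-++⁺ˡ (∈-map⁺ _ (Bump⇒∈bumps b))
Bump⇒∈bumps {m = x ∷ m} {k = suc k} (bump b) = ∈-++⁺ʳ (map (x ∷_) (bumps m (suc k))) (∈-map⁺ _ (Bump⇒∈bumps b))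

sum-Bump : ∀ {n} {m v : Vec ℕ n} {k} → Bump m k v → sum v ≡ sum m + k
sum-Bump []                                = refl
sum-Bump {m = x ∷ m} {k = k}     (keep b) = trans (cong (x +_) (sum-Bump b)) (sym (+-assoc x (sum m) k))
sum-Bump {m = x ∷ m} {v = _ ∷ v} {k = suc k} (bump b) = begin
  suc (x + sum v)         ≡⟨ cong (λ s → suc (x + s)) (sum-Bump b) ⟩
  suc (x + (sum m + k))   ≡⟨ cong suc (+-assoc x (sum m) k) ⟨
  suc (x + sum m + k)     ≡⟨ +-suc (x + sum m) k ⟨
  x + sum m + suc k       ∎
  where open ≡-Reasoning

between⇒∃Bump : ∀ {n} (m v : Vec ℕ n) → (∀ i → lookup m i ≤ lookup v i) → (∀ i → lookup v i ≤ suc (lookup m i)) →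
                ∃ λ k → Bump m k v
between⇒∃Bump []      []      _   _     = 0 , []
between⇒∃Bump (x ∷ m) (y ∷ v) m≤v v≤1+m with k , b ← between⇒∃Bump m v (m≤v ∘ suc) (v≤1+m ∘ suc)
                                          | m≤n⇒m<n∨m≡n (m≤v zero)
... | inj₂ refl = k , keep b
... | inj₁ x<y with refl ← ≤-antisym (v≤1+m zero) x<y = suc k , bump b

Bump-between : ∀ {n} (m v : Vec ℕ n) → (∀ i → lookup m i ≤ lookup v i) → (∀ i → lookup v i ≤ suc (lookup m i)) →
               Bump m (sum v ∸ sum m) v
Bump-between m v m≤v v≤1+m with k , b ← between⇒∃Bump m v m≤v v≤1+m =
  subst (λ j → Bump m j v) (sym (trans (cong (_∸ sum m) (sum-Bump b)) (m+n∸m≡n (sum m) k))) b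

x∈xs⇒x≤foldr⊔ : ∀ {x} (xs : List ℕ) → x ∈ xs → x ≤ foldr _⊔_ 0 xs
x∈xs⇒x≤foldr⊔ xs x∈xs =
  foldr-preservesᵒ (λ y z → [ m≤n⇒m≤n⊔o z , m≤n⇒m≤o⊔n y ]′) 0 xs (inj₂ (lose x∈xs ≤-refl))

nCk≤K : ∀ n k → n C k ≤ K n
nCk≤K n k with k ≤? n
... | yes k≤n = x∈xs⇒x≤foldr⊔ _ (∈-map⁺ (n C_) (∈-upTo⁺ (s≤s k≤n)))
... | no  k≰n = subst (_≤ K n) (sym (k>n⇒nCk≡0 (≰⇒> k≰n))) z≤n

module _ {N : ℕ} where

  AtMostOneMore : Word N → Word N → Set
  AtMostOneMore u v = ∀ a → count a u ≤ suc (count a v)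

  CountsWithinOne : Word N → Word N → Set
  CountsWithinOne u v = AtMostOneMore u v × AtMostOneMore v u

  open import Data.List.Relation.Unary.Unique.DecPropositional.Properties {A = Vec ℕ N} (Vecₚ.≡-dec _≟_)
    using (deduplicate-!)

  #distinct-⊆ : ∀ {xs ys : List (Vec ℕ N)} → xs ⊆ ys → #distinct xs ≤ length ys
  #distinct-⊆ {xs} xs⊆ys = Unique-⊆⇒length≤ (deduplicate-! xs) (xs⊆ys ∘ ∈-deduplicate⁻ (Vecₚ.≡-dec _≟_) xs)

  #distinct-Ψ≤K : ∀ n (L : List (Word N)) → (∀ {u} → u ∈ L → length u ≡ n) →
                  (∀ {u v} → u ∈ L → v ∈ L → AtMostOneMore u v) → #distinct (map Ψ L) ≤ K N
  #distinct-Ψ≤K n []        _        _     = z≤n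
  #distinct-Ψ≤K n (u₀ ∷ L′) length≡n close = begin
    #distinct (map Ψ (u₀ ∷ L′)) ≤⟨ #distinct-⊆ Ψ[L]⊆bumps ⟩
    length (bumps m k)          ≡⟨ length-bumps m k ⟩
    N C k                       ≤⟨ nCk≤K N k ⟩
    K N                         ∎
    where
    open ≤-Reasoning
    L : List (Word N)
    L = u₀ ∷ L′

    minimiser : Fin N → Word N
    minimiser a = argmin (count a) u₀ L′

    minimiser∈L : ∀ a → minimiser a ∈ L
    minimiser∈L a with argmin-sel (count a) u₀ L′
    ... | inj₁ ≡u₀ = here ≡u₀
    ... | inj₂ ∈L′ = there ∈L′

    minimiser-≤ : ∀ a {u} → u ∈ L → count a (minimiser a) ≤ count a u
    minimiser-≤ a = All.lookup (f[argmin]≤f[⊤] {f = count a} u₀ L′ ∷ f[argmin]≤f[xs] u₀ L′)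

    m : Vec ℕ N
    m = tabulate λ a → count a (minimiser a)

    k : ℕ
    k = n ∸ sum m

    Ψ-Bump : ∀ {u} → u ∈ L → Bump m k (Ψ u)
    Ψ-Bump {u} u∈L = subst (λ s → Bump m (s ∸ sum m) (Ψ u)) (trans (sum-Ψ u) (length≡n u∈L))
                           (Bump-between m (Ψ u) m≤Ψu Ψu≤1+m)
      where
      m≤Ψu : ∀ a → lookup m a ≤ lookup (Ψ u) a
      m≤Ψu a rewrite Vecₚ.lookup∘tabulate (λ a → count a (minimiser a)) a
                   | Vecₚ.lookup∘tabulate (λ a → count a u) a = minimiser-≤ a u∈L
      Ψu≤1+m : ∀ a → lookup (Ψ u) a ≤ suc (lookup m a)
      Ψu≤1+m a rewrite Vecₚ.lookup∘tabulate (λ a → count a (minimiser a)) a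
                     | Vecₚ.lookup∘tabulate (λ a → count a u) a = close u∈L (minimiser∈L a) a

    Ψ[L]⊆bumps : map Ψ L ⊆ bumps m k
    Ψ[L]⊆bumps v∈Ψ[L] with u , u∈L , refl ← ∈-map⁻ Ψ v∈Ψ[L] = Bump⇒∈bumps (Ψ-Bump u∈L)

  balanced-factors : ∀ {x : Word N} → Balanced x → ∀ {i j m} → i + m ≤ length x → j + m ≤ length x →
                     AtMostOneMore (take m (drop i x)) (take m (drop j x))
  balanced-factors {x} (_ , balanced) {i} {j} {m} i+m≤ j+m≤ a =
    ∣⊖∣≤1⇒≤suc cᵢ cⱼ (subst (λ z → ∣ z ∣ ≤ 1) (m-n≡m⊖n cᵢ cⱼ)
      (balanced _ _ (take-drop-Factor m i x) (take-drop-Factor m j x) same-length a))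
    where
    cᵢ cⱼ : ℕ
    cᵢ = count a (take m (drop i x))
    cⱼ = count a (take m (drop j x))
    same-length : length (take m (drop i x)) ≡ length (take m (drop j x))
    same-length = trans (length-take-drop i m x i+m≤) (sym (length-take-drop j m x j+m≤))

  ∈factorsOfLength⁻ : ∀ {n} {w u : Word N} → n ≤ length w → u ∈ factorsOfLength n w →
                      ∃ λ i → i + n ≤ length w × u ≡ take n (drop i w)
  ∈factorsOfLength⁻ {n} {w} n≤ℓ u∈ with i , s≤s i≤ℓ∸n , refl ← ∈-applyUpTo⁻ (λ i → take n (drop i w)) u∈ =
    i , subst (i + n ≤_) (m∸n+n≡m n≤ℓ) (+-monoˡ-≤ n i≤ℓ∸n) , refl

  ρab≤K : ∀ {w : Word N} {n} → Balanced w → n ≤ length w → ρab n w ≤ K N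
  ρab≤K {w} {n} balanced n≤ℓ = #distinct-Ψ≤K n (factorsOfLength n w) length≡n close
    where
    length≡n : ∀ {u} → u ∈ factorsOfLength n w → length u ≡ n
    length≡n u∈ with i , i+n≤ , refl ← ∈factorsOfLength⁻ n≤ℓ u∈ = length-take-drop i n w i+n≤
    close : ∀ {u v} → u ∈ factorsOfLength n w → v ∈ factorsOfLength n w → AtMostOneMore u v
    close u∈ v∈ with i , i+n≤ , refl ← ∈factorsOfLength⁻ n≤ℓ u∈
                   | j , j+n≤ , refl ← ∈factorsOfLength⁻ n≤ℓ v∈ = balanced-factors balanced {i} {j} i+n≤ j+n≤

  arc : ℕ → ℕ → Word N → Word N
  arc p n w = take n (drop p (w ++ w))

  arc-inside : ∀ {p m} (w : Word N) → p + m ≤ length w → arc p m w ≡ take m (drop p w)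
  arc-inside {p} {m} w = take-drop-++ˡ p m w w

  arc-wrap : ∀ s m (w : Word N) → arc (length w + s) m w ≡ take m (drop s w)
  arc-wrap s m w = cong (take m) (drop-length-++ w w s)

  arc-full : ∀ {p} (w : Word N) → p ≤ length w → arc p (length w) w ≡ rotate p w
  arc-full {p} w p≤ℓ = begin
    take (length w) (drop p (w ++ w))            ≡⟨ cong (take (length w)) (drop-++ˡ p w w p≤ℓ) ⟩
    take (length w) (drop p w ++ w)              ≡⟨ cong (λ l → take l (drop p w ++ w)) ℓ≡ ⟩
    take (length (drop p w) + p) (drop p w ++ w) ≡⟨ take-length-++ (drop p w) w p ⟩
    drop p w ++ take p w                         ∎
    where
    open ≡-Reasoning
    ℓ≡ : length w ≡ length (drop p w) + p
    ℓ≡ = sym (trans (cong (_+ p) (length-drop p w)) (m∸n+n≡m p≤ℓ))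

  length-rotate : ∀ {p} (w : Word N) → p ≤ length w → length (rotate p w) ≡ length w
  length-rotate {p} w p≤ℓ = begin
    length (rotate p w)         ≡⟨ cong length (arc-full w p≤ℓ) ⟨
    length (arc p (length w) w) ≡⟨ length-take-drop p (length w) (w ++ w) p+ℓ≤ ⟩
    length w                    ∎
    where
    open ≡-Reasoning
    p+ℓ≤ : p + length w ≤ length (w ++ w)
    p+ℓ≤ = subst (p + length w ≤_) (sym (length-++ w)) (+-monoˡ-≤ (length w) p≤ℓ)

  arc-++ : ∀ p m k (w : Word N) → arc p m w ++ arc (p + m) k w ≡ arc p (m + k) w
  arc-++ p m k w = begin
    take m (drop p c) ++ take k (drop (p + m) c)    ≡⟨ cong (λ l → take m (drop p c) ++ take k l) (drop-drop p m c) ⟨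
    take m (drop p c) ++ take k (drop m (drop p c)) ≡⟨ take-+ m k (drop p c) ⟨
    take (m + k) (drop p c)                         ∎
    where
    open ≡-Reasoning
    c : Word N
    c = w ++ w

  count-arc-complement : ∀ {p n} (w : Word N) a → p ≤ length w → n ≤ length w →
                         count a (arc p n w) + count a (arc (p + n) (length w ∸ n) w) ≡ count a w
  count-arc-complement {p} {n} w a p≤ℓ n≤ℓ = begin
    count a (arc p n w) + count a (arc (p + n) (length w ∸ n) w) ≡⟨ count-++ a (arc p n w) _ ⟨
    count a (arc p n w ++ arc (p + n) (length w ∸ n) w)          ≡⟨ cong (count a) (arc-++ p n (length w ∸ n) w) ⟩
    count a (arc p (n + (length w ∸ n)) w)                       ≡⟨ cong (λ l → count a (arc p l w)) (m+[n∸m]≡n n≤ℓ) ⟩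
    count a (arc p (length w) w)                                 ≡⟨ cong (count a) (arc-full w p≤ℓ) ⟩
    count a (rotate p w)                                         ≡⟨ count-rotate a p w ⟩
    count a w                                                    ∎
    where open ≡-Reasoning

  rotate-++-rotate : ∀ {p} (w : Word N) → p ≤ length w → rotate p w ++ rotate p w ≡ drop p (w ++ w) ++ take p w
  rotate-++-rotate {p} w p≤ℓ = begin
    (drop p w ++ take p w) ++ (drop p w ++ take p w) ≡⟨ ++-assoc (drop p w) (take p w) _ ⟩
    drop p w ++ (take p w ++ (drop p w ++ take p w)) ≡⟨ cong (drop p w ++_) (++-assoc (take p w) (drop p w) _) ⟨
    drop p w ++ ((take p w ++ drop p w) ++ take p w) ≡⟨ cong (λ l → drop p w ++ (l ++ take p w)) (take++drop≡id p w) ⟩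
    drop p w ++ (w ++ take p w)                      ≡⟨ ++-assoc (drop p w) w (take p w) ⟨
    (drop p w ++ w) ++ take p w                      ≡⟨ cong (_++ take p w) (drop-++ˡ p w w p≤ℓ) ⟨
    drop p (w ++ w) ++ take p w                      ∎
    where open ≡-Reasoning

  arc-rotate : ∀ {p d n} (w : Word N) → p ≤ length w → p + (d + n) ≤ length w + length w →
               arc d n (rotate p w) ≡ arc (p + d) n w
  arc-rotate {p} {d} {n} w p≤ℓ p+d+n≤ = begin
    take n (drop d (rotate p w ++ rotate p w)) ≡⟨ cong (take n ∘ drop d) (rotate-++-rotate w p≤ℓ) ⟩
    take n (drop d (drop p c ++ take p w))     ≡⟨ take-drop-++ˡ d n (drop p c) (take p w) d+n≤ ⟩
    take n (drop d (drop p c))                 ≡⟨ cong (take n) (drop-drop p d c) ⟩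
    take n (drop (p + d) c)                    ∎
    where
    open ≡-Reasoning
    c : Word N
    c = w ++ w
    d+n≤ : d + n ≤ length (drop p c)
    d+n≤ = subst (d + n ≤_) (sym (trans (length-drop p c) (cong (_∸ p) (length-++ w))))
                 (m+n≤o⇒n≤o∸m p p+d+n≤)

  AtMostOneMore-complement : ∀ {u u′ v v′ : Word N} → (∀ a → count a u + count a u′ ≡ count a v + count a v′) →
                             AtMostOneMore v′ u′ → AtMostOneMore u v
  AtMostOneMore-complement {u} {u′} {v} {v′} sums≡ v′≤1+u′ a = +-cancelʳ-≤ (count a u′) _ _ (begin
    count a u + count a u′       ≡⟨ sums≡ a ⟩
    count a v + count a v′       ≤⟨ +-monoʳ-≤ (count a v) (v′≤1+u′ a) ⟩
    count a v + suc (count a u′) ≡⟨ +-suc (count a v) (count a u′) ⟩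
    suc (count a v) + count a u′ ∎)
    where open ≤-Reasoning

  balanced-inner-arcs-close : ∀ {x : Word N} {n d} → Balanced x → d + n ≤ length x →
                              CountsWithinOne (arc 0 n x) (arc d n x)
  balanced-inner-arcs-close {x} {n} {d} balanced d+n≤ℓ =
    subst₂ AtMostOneMore arc₀ arcᵈ (balanced-factors balanced {0} {d} n≤ℓ d+n≤ℓ) ,
    subst₂ AtMostOneMore arcᵈ arc₀ (balanced-factors balanced {d} {0} d+n≤ℓ n≤ℓ)
    where
    n≤ℓ : n ≤ length x
    n≤ℓ = m+n≤o⇒n≤o d d+n≤ℓ
    arc₀ : take n (drop 0 x) ≡ arc 0 n x
    arc₀ = sym (arc-inside x n≤ℓ)
    arcᵈ : take n (drop d x) ≡ arc d n x
    arcᵈ = sym (arc-inside x d+n≤ℓ)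

  balanced-wrapping-arcs-close : ∀ {x : Word N} {n s} → Balanced x → n ≤ length x → s + (length x ∸ n) ≤ length x →
                                 let d = s + (length x ∸ n) in
                                 CountsWithinOne (arc 0 n x) (arc d n x)
  balanced-wrapping-arcs-close {x} {n} {s} balanced n≤ℓ d≤ℓ =
    AtMostOneMore-complement {arc 0 n x} {co₀} {arc d n x} {coᵈ} sums≡ (balanced-factors balanced {s} {n} d≤ℓ n+e≤ℓ) ,
    AtMostOneMore-complement {arc d n x} {coᵈ} {arc 0 n x} {co₀} (sym ∘ sums≡) (balanced-factors balanced {n} {s} n+e≤ℓ d≤ℓ)
    where
    open ≡-Reasoning
    ℓ e d : ℕ
    ℓ = length x
    e = ℓ ∸ n
    d = s + e
    co₀ coᵈ : Word N
    co₀ = take e (drop n x)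
    coᵈ = take e (drop s x)
    n+e≡ℓ : n + e ≡ ℓ
    n+e≡ℓ = m+[n∸m]≡n n≤ℓ
    n+e≤ℓ : n + e ≤ ℓ
    n+e≤ℓ = ≤-reflexive n+e≡ℓ
    d+n≡ℓ+s : d + n ≡ ℓ + s
    d+n≡ℓ+s = begin
      s + e + n   ≡⟨ +-assoc s e n ⟩
      s + (e + n) ≡⟨ cong (s +_) (trans (+-comm e n) n+e≡ℓ) ⟩
      s + ℓ       ≡⟨ +-comm s ℓ ⟩
      ℓ + s       ∎
    complement₀ : arc (0 + n) e x ≡ co₀
    complement₀ = arc-inside x n+e≤ℓ
    complementᵈ : arc (d + n) e x ≡ coᵈ
    complementᵈ = trans (cong (λ p → arc p e x) d+n≡ℓ+s) (arc-wrap s e x)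
    sums≡ : ∀ a → count a (arc 0 n x) + count a co₀ ≡ count a (arc d n x) + count a coᵈ
    sums≡ a = begin
      count a (arc 0 n x) + count a co₀               ≡⟨ cong (λ c → count a (arc 0 n x) + count a c) complement₀ ⟨
      count a (arc 0 n x) + count a (arc (0 + n) e x) ≡⟨ count-arc-complement x a z≤n n≤ℓ ⟩
      count a x                                       ≡⟨ count-arc-complement x a d≤ℓ n≤ℓ ⟨
      count a (arc d n x) + count a (arc (d + n) e x) ≡⟨ cong (λ c → count a (arc d n x) + count a c) complementᵈ ⟩
      count a (arc d n x) + count a coᵈ               ∎

  balanced-arcs-close : ∀ {x : Word N} {n d} → Balanced x → n ≤ length x → d ≤ length x →
                        CountsWithinOne (arc 0 n x) (arc d n x)
  balanced-arcs-close {x} {n} {d} balanced n≤ℓ d≤ℓ with ≤-total d (length x ∸ n)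
  ... | inj₁ d≤e = balanced-inner-arcs-close {x} {n} {d} balanced (subst (d + n ≤_) (m∸n+n≡m n≤ℓ) (+-monoˡ-≤ n d≤e))
  ... | inj₂ e≤d = subst (λ d → CountsWithinOne (arc 0 n x) (arc d n x)) s+e≡d
                         (balanced-wrapping-arcs-close balanced n≤ℓ (subst (_≤ length x) (sym s+e≡d) d≤ℓ))
    where
    s+e≡d : d ∸ (length x ∸ n) + (length x ∸ n) ≡ d
    s+e≡d = m∸n+n≡m e≤d

  rotation-arcs-close : ∀ {w : Word N} {n p q} → BalancedCircular w → n ≤ length w → p ≤ q → q < length w →
                        CountsWithinOne (arc p n w) (arc q n w)
  rotation-arcs-close {w} {n} {p} {q} balancedᶜ n≤ℓ p≤q q<ℓ =
    subst₂ CountsWithinOne arc₀ arcᵈ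
      (balanced-arcs-close (balancedᶜ x (inj₂ (p , ≤-<-trans p≤q q<ℓ , refl))) n≤∣x∣ d≤∣x∣)
    where
    ℓ d : ℕ
    ℓ = length w
    d = q ∸ p
    x : Word N
    x = rotate p w
    q≤ℓ : q ≤ ℓ
    q≤ℓ = <⇒≤ q<ℓ
    p≤ℓ : p ≤ ℓ
    p≤ℓ = ≤-trans p≤q q≤ℓ
    p+d≡q : p + d ≡ q
    p+d≡q = m+[n∸m]≡n p≤q
    n≤∣x∣ : n ≤ length x
    n≤∣x∣ = subst (n ≤_) (sym (length-rotate w p≤ℓ)) n≤ℓ
    d≤∣x∣ : d ≤ length x
    d≤∣x∣ = subst (d ≤_) (sym (length-rotate w p≤ℓ)) (≤-trans (m∸n≤m q p) q≤ℓ)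
    q+n≤ : q + n ≤ ℓ + ℓ
    q+n≤ = +-mono-≤ q≤ℓ n≤ℓ
    arc₀ : arc 0 n x ≡ arc p n w
    arc₀ = trans (arc-rotate w p≤ℓ (≤-trans (+-monoˡ-≤ n p≤q) q+n≤)) (cong (λ r → arc r n w) (+-identityʳ p))
    arcᵈ : arc d n x ≡ arc q n w
    arcᵈ = trans (arc-rotate w p≤ℓ (subst (_≤ ℓ + ℓ) (trans (cong (_+ n) (sym p+d≡q)) (+-assoc p d n)) q+n≤))
                 (cong (λ r → arc r n w) p+d≡q)

  circular-arcs-close : ∀ {w : Word N} {n p q} → BalancedCircular w → n ≤ length w → p < length w → q < length w →
                        AtMostOneMore (arc p n w) (arc q n w)
  circular-arcs-close {p = p} {q} balancedᶜ n≤ℓ p<ℓ q<ℓ with ≤-total p q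
  ... | inj₁ p≤q = proj₁ (rotation-arcs-close balancedᶜ n≤ℓ p≤q q<ℓ)
  ... | inj₂ q≤p = proj₂ (rotation-arcs-close balancedᶜ n≤ℓ q≤p p<ℓ)

  arc-reduce : ∀ {n k j} (w : Word N) → k < length w → j + n ≤ length w →
               ∃ λ p → p < length w × arc (k + j) n w ≡ arc p n w
  arc-reduce {n} {k} {j} w k<ℓ j+n≤ℓ with k + j <? length w
  ... | yes k+j<ℓ = k + j , k+j<ℓ , refl
  ... | no  k+j≮ℓ = s , s<ℓ , arc-k+j≡arc-s
    where
    ℓ s : ℕ
    ℓ = length w
    s = k + j ∸ ℓ
    ℓ+s≡k+j : ℓ + s ≡ k + j
    ℓ+s≡k+j = m+[n∸m]≡n (≮⇒≥ k+j≮ℓ)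
    s<j : s < j
    s<j = +-cancelˡ-< ℓ s j (subst (_< ℓ + j) (sym ℓ+s≡k+j) (+-monoˡ-< j k<ℓ))
    s<ℓ : s < ℓ
    s<ℓ = <-≤-trans s<j (m+n≤o⇒m≤o j j+n≤ℓ)
    arc-k+j≡arc-s : arc (k + j) n w ≡ arc s n w
    arc-k+j≡arc-s = begin
      arc (k + j) n w   ≡⟨ cong (λ r → arc r n w) ℓ+s≡k+j ⟨
      arc (ℓ + s) n w   ≡⟨ arc-wrap s n w ⟩
      take n (drop s w) ≡⟨ arc-inside w (≤-trans (+-monoˡ-≤ n (<⇒≤ s<j)) j+n≤ℓ) ⟨
      arc s n w         ∎
      where open ≡-Reasoning

  factor-of-rotation⇒arc : ∀ {n k} {w u : Word N} → n ≤ length w → k < length w → u ∈ factorsOfLength n (rotate k w) →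
                           ∃ λ p → p < length w × u ≡ arc p n w
  factor-of-rotation⇒arc {n} {k} {w} n≤ℓ k<ℓ u∈
    with ∈factorsOfLength⁻ (subst (n ≤_) (sym (length-rotate w (<⇒≤ k<ℓ))) n≤ℓ) u∈
  ... | j , j+n≤∣x∣ , refl = map₂ (map₂ (trans factor≡arc)) (arc-reduce w k<ℓ j+n≤ℓ)
    where
    open ≡-Reasoning
    j+n≤ℓ : j + n ≤ length w
    j+n≤ℓ = subst (j + n ≤_) (length-rotate w (<⇒≤ k<ℓ)) j+n≤∣x∣
    factor≡arc : take n (drop j (rotate k w)) ≡ arc (k + j) n w
    factor≡arc = begin
      take n (drop j (rotate k w)) ≡⟨ arc-inside (rotate k w) j+n≤∣x∣ ⟨
      arc j n (rotate k w)         ≡⟨ arc-rotate w (<⇒≤ k<ℓ) (+-mono-≤ (<⇒≤ k<ℓ) j+n≤ℓ) ⟩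
      arc (k + j) n w              ∎

  ∈circFactorsOfLength⁻ : ∀ {n} {w u : Word N} → n ≤ length w → u ∈ circFactorsOfLength n w →
                          ∃ λ p → p < length w × u ≡ arc p n w
  ∈circFactorsOfLength⁻ {n} {w} n≤ℓ u∈
    with k , k∈ , u∈ᵏ ← find (∈-concatMap⁻ (λ k → factorsOfLength n (rotate k w)) {xs = upTo (length w)} u∈) =
    factor-of-rotation⇒arc n≤ℓ (∈-upTo⁻ k∈) u∈ᵏ

  ρabCirc≤K : ∀ {w : Word N} {n} → BalancedCircular w → n ≤ length w → ρabCirc n w ≤ K N
  ρabCirc≤K {w} {n} balancedᶜ n≤ℓ = #distinct-Ψ≤K n (circFactorsOfLength n w) length≡n close
    where
    length≡n : ∀ {u} → u ∈ circFactorsOfLength n w → length u ≡ n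
    length≡n u∈ with p , p<ℓ , refl ← ∈circFactorsOfLength⁻ {w = w} n≤ℓ u∈ =
      length-take-drop p n (w ++ w) (subst (p + n ≤_) (sym (length-++ w)) (+-mono-≤ (<⇒≤ p<ℓ) n≤ℓ))
    close : ∀ {u v} → u ∈ circFactorsOfLength n w → v ∈ circFactorsOfLength n w → AtMostOneMore u v
    close u∈ v∈ with p , p<ℓ , refl ← ∈circFactorsOfLength⁻ {w = w} n≤ℓ u∈
                   | q , q<ℓ , refl ← ∈circFactorsOfLength⁻ {w = w} n≤ℓ v∈ = circular-arcs-close balancedᶜ n≤ℓ p<ℓ q<ℓ

lemma1 : (N : ℕ) → 1 ≤ N →
    ((w : Word N) → Balanced w → AllLettersOccur w →
       (n : ℕ) → 1 ≤ n → n ≤ length w → ρab n w ≤ K N)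
    ×
    ((w : Word N) → BalancedCircular w → AllLettersOccur w →
       (n : ℕ) → 1 ≤ n → n ≤ length w → ρabCirc n w ≤ K N)
lemma1 _ _ = (λ _ balanced _ _ _ → ρab≤K balanced) , (λ _ balancedᶜ _ _ _ → ρabCirc≤K balancedᶜ)
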